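{- Let $m\geq 4$ be an integer and let $G$ be a finite $m$-free digraph. Then for every $v\in V(G)$ and every integer $k$ with $1\leq k\leq m-3$: $$p_k(v)=|E(N_{k+1}^+(v),N_{k+2}^+(v))|,\qquad q_k(v)\leq |\bar{E}(N_{k+1}^-(v),N_{1}^+(v))|,\qquad r_k(v)\leq |\bar{E}(N_{1}^-(v),N_{k+2}^-(v))|,$$ $$p'_k(v)\leq |\bar{E}(N_{1}^+(v),N_{k+2}^+(v))|,\qquad q'_k(v)\leq |\bar{E}(N_{k+1}^+(v),N_{1}^-(v))|,\qquad r'_k(v)=|E(N_{k+2}^-(v),N_{k+1}^-(v))|.$$
   Context: Digraphs have no loops and no parallel edges. A digraph is $m$-free if it has no directed cycle of length at most $m$. For disjoint vertex sets $A,B$, $E(A,B)$ is the set of edges $(a,b)$ with $a\in A$, $b\in B$, and $\bar{E}(A,B)$ is the set of pairs $(a,b)\in A\times B$ such that neither $(a,b)$ nor $(b,a)$ is an edge (so $|\bar E(A,B)|=|A||B|-|E(A,B)|-|E(B,A)|$). A directed path of length $\ell$ is a sequence of $\ell+1$ distinct vertices $(v_0,\dots,v_\ell)$ with $(v_i,v_{i+1})\in E(G)$ for all $i$; it is induced if every edge of the subgraph induced by its vertex set is one of the $(v_i,v_{i+1})$. For a vertex $v$ and $i\ge1$, $N_i^+(v)$ (resp. $N_i^-(v)$) is the set of vertices $u$ such that the shortest directed $(v,u)$-path (resp. $(u,v)$-path) has length exactly $i$. An induced directed path $(v_0,\dots,v_\ell)$ is shortest if $v_\ell\in N_\ell^+(v_0)$;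 $\mathscr{P}(G)$ is the set of shortest induced directed paths. For a path $P$ and vertices $x,y,z$, $(x,P,y,z)$ denotes the concatenated vertex sequence. For $v\in V(G)$ and $1\le k\le m-3$: $P_k(v)$, $Q_k(v)$, $R_k(v)$ are the sets of triples $(x,y,z)$ with $x=v$, $y=v$, $z=v$ respectively, such that $(x,P,y,z)\in\mathscr{P}(G)$ for some $P\in\mathscr{P}(G)$ of length $k-1$; $P'_k(v)$, $Q'_k(v)$, $R'_k(v)$ are the sets of triples $(x,y,z)$ with $x=v$, $y=v$, $z=v$ respectively, such that $(x,y,P,z)\in\mathscr{P}(G)$ for some $P\in\mathscr{P}(G)$ of length $k-1$. Lower-case letters denote cardinalities: $p_k(v)=|P_k(v)|$, $q_k(v)=|Q_k(v)|$, $r_k(v)=|R_k(v)|$, $p'_k(v)=|P'_k(v)|$, $q'_k(v)=|Q'_k(v)|$, $r'_k(v)=|R'_k(v)|$. -}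

module Defs where

open import Data.Nat using (ℕ; zero; suc; _+_; _≤_)
open import Data.Fin using (Fin; toℕ; fromℕ) renaming (zero to fzero)
open import Data.Bool using (Bool; true; false)
open import Data.Product using (Σ; ∃; ∃-syntax; _×_; _,_)
open import Data.List using (List; length)
open import Data.List.Membership.Propositional using (_∈_)
open import Data.List.Relation.Unary.Unique.Propositional using (Unique)
open import Data.Vec.Functional using (Vector; _∷_; _++_; [])
open import Relation.Binary.PropositionalEquality using (_≡_)
open import Relation.Nullary using (¬_)
open import Function using (_⇔_)
open import Data.Empty using (⊥)
open import Function.Definitions using (Injective)

-- A finite digraph on vertex set Fin n: adjacency relation given by a
-- Bool-valued function (so at most one edge (u,v) for each ordered pair:
-- no parallel edges), with no loops.
record Digraph (n : ℕ) : Set where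
  field
    adj      : Fin n → Fin n → Bool
    loopless : ∀ v → adj v v ≡ false

module _ {n : ℕ} (G : Digraph n) where
  open Digraph G

  V : Set
  V = Fin n

  Edge : V → V → Set
  Edge u w = adj u w ≡ true

  -- A vertex sequence with r vertices (Fin r → V) is a directed path
  -- (of length r - 1): distinct vertices, consecutive ones joined by edges.
  IsPath : {r : ℕ} → Vector V r → Set
  IsPath {r} p = Injective _≡_ _≡_ p
               × (∀ (i j : Fin r) → toℕ j ≡ suc (toℕ i) → Edge (p i) (p j))

  IsInducedPath : {r : ℕ} → Vector V r → Set
  IsInducedPath {r} p = IsPath p
                      × (∀ (i j : Fin r) → Edge (p i) (p j) → toℕ j ≡ suc (toℕ i))

  PathOfLen : V → V → ℕ → Set
  PathOfLen u w ℓ = Σ (Vector V (suc ℓ)) λ p →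
    IsPath p × p fzero ≡ u × p (fromℕ ℓ) ≡ w

  Dist : V → V → ℕ → Set
  Dist u w ℓ = PathOfLen u w ℓ × (∀ j → PathOfLen u w j → ℓ ≤ j)

  Nout : ℕ → V → V → Set
  Nout i v u = 1 ≤ i × Dist v u i

  Nin : ℕ → V → V → Set
  Nin i v u = 1 ≤ i × Dist u v i

  -- G contains a directed cycle of length suc j
  HasCycleOfLen : ℕ → Set
  HasCycleOfLen j = Σ (Vector V (suc j)) λ c → IsPath c × Edge (c (fromℕ j)) (c fzero)

  MFree : ℕ → Set
  MFree m = ∀ j → suc j ≤ m → ¬ HasCycleOfLen j

  ShortestInduced : {ℓ : ℕ} → Vector V (suc ℓ) → Set
  ShortestInduced {ℓ} p = IsInducedPath p × Dist (p fzero) (p (fromℕ ℓ)) ℓ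

  InP : (r : ℕ) → Vector V r → Set
  InP zero    _ = ⊥
  InP (suc ℓ) p = ShortestInduced p

  Triple : Set
  Triple = V × V × V

  -- (x,P,y,z) ∈ 𝒫(G) for some P ∈ 𝒫(G) of length k-1 (P has k vertices)
  XPYZ : ℕ → Triple → Set
  XPYZ k (x , y , z) = Σ (Vector V k) λ P →
    InP k P × ShortestInduced (x ∷ (P ++ (y ∷ (z ∷ []))))

  XYPZ : ℕ → Triple → Set
  XYPZ k (x , y , z) = Σ (Vector V k) λ P →
    InP k P × ShortestInduced (x ∷ (y ∷ (P ++ (z ∷ []))))

  Pk Qk Rk Pk' Qk' Rk' : ℕ → V → Triple → Set
  Pk  k v (x , y , z) = x ≡ v × XPYZ k (x , y , z)
  Qk  k v (x , y , z) = y ≡ v × XPYZ k (x , y , z)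
  Rk  k v (x , y , z) = z ≡ v × XPYZ k (x , y , z)
  Pk' k v (x , y , z) = x ≡ v × XYPZ k (x , y , z)
  Qk' k v (x , y , z) = y ≡ v × XYPZ k (x , y , z)
  Rk' k v (x , y , z) = z ≡ v × XYPZ k (x , y , z)

  EdgesBetween : (V → Set) → (V → Set) → V × V → Set
  EdgesBetween A B (a , b) = A a × B b × Edge a b

  NonEdgesBetween : (V → Set) → (V → Set) → V × V → Set
  NonEdgesBetween A B (a , b) = A a × B b × ¬ Edge a b × ¬ Edge b a

IsCard : {A : Set} → (A → Set) → ℕ → Set
IsCard {A} S c = Σ (List A) λ l → Unique l × (∀ x → (x ∈ l) ⇔ S x) × length l ≡ c

module Submission where

-- Every triple counted by p_k, q_k, r_k, p'_k, q'_k, r'_k is read off a shortest induced path of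
-- length k + 2 through x, y, z, with y at position k + 1 or 1. Subpaths of shortest paths are
-- shortest, so the positions give the distances from or to v, and inducedness gives the non-edges;
-- forgetting the coordinate equal to v is then an injection into the right-hand set. For p_k and r'_k
-- it is also onto: a shortest path from v to y followed by an edge y → z with d(v, z) = k + 2 is again
-- shortest, and in an m-free digraph every shortest path of length below m is induced.

open import Defs
open import Data.Nat using (ℕ; zero; suc; _+_; _∸_; _≤_; _<_; z≤n; s≤s; _≤?_; _<?_)
open import Data.Nat.Properties
  using (≤-refl; ≤-trans; ≤-antisym; ≤-pred; <⇒≤; <⇒≢; <-irrefl; <-asym; <-trans; <-≤-trans;
         ≰⇒>; 1+n≰n; n≤1+n; n<1+n; m≤n⇒m≤1+n; m≤n⇒m<n∨m≡n; +-identityʳ; +-suc; +-comm;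
         +-cancelˡ-≡; +-monoʳ-≤; m∸n≤m; m+[n∸m]≡n; m∸n+n≡m; m≤o∸n⇒m+n≤o; anyUpTo?)
open import Data.Fin using (Fin; toℕ; fromℕ; fromℕ<; splitAt; _↑ʳ_; _≟_)
  renaming (zero to fzero; suc to fsuc)
open import Data.Fin.Properties
  using (injective⇒≤; toℕ-fromℕ<; fromℕ<-toℕ; fromℕ<-injective; toℕ<n; toℕ≤pred[n];
         toℕ-injective; toℕ-fromℕ; toℕ-↑ˡ; toℕ-↑ʳ; splitAt⁻¹-↑ˡ; splitAt⁻¹-↑ʳ)
open import Data.Empty using (⊥-elim)
open import Data.Product using (Σ; ∃; _×_; _,_; proj₁; proj₂; swap)
open import Data.Sum using (inj₁; inj₂)
open import Data.List using (List; length; lookup)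
open import Data.List.Relation.Unary.All as All using ()
open import Data.List.Relation.Unary.AllPairs using (_∷_)
open import Data.List.Relation.Unary.Any using (index)
open import Data.List.Relation.Unary.Unique.Propositional using (Unique)
open import Data.List.Membership.Propositional using (_∈_)
open import Data.List.Membership.Propositional.Properties using (∈-lookup)
open import Data.List.Membership.Setoid.Properties using (index-injective)
open import Data.Vec.Functional using (Vector; _++_) renaming (_∷_ to _∷ᵥ_; [] to []ᵥ)
open import Data.Vec.Functional.Properties using (lookup-++ʳ)
open import Function using (Equivalence)
open import Relation.Binary.PropositionalEquality
  using (_≡_; refl; sym; trans; cong; cong₂; subst; subst₂; setoid)
open import Relation.Nullary using (¬_; yes; no)

unique⇒lookup-injective : {A : Set} {xs : List A} → Unique xs →
  ∀ {i j} → lookup xs i ≡ lookup xs j → i ≡ j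
unique⇒lookup-injective (x∉xs ∷ _) {fzero} {fzero} _ = refl
unique⇒lookup-injective (x∉xs ∷ _) {fzero} {fsuc j} eq =
  ⊥-elim (All.lookup x∉xs (∈-lookup j) eq)
unique⇒lookup-injective (x∉xs ∷ _) {fsuc i} {fzero} eq =
  ⊥-elim (All.lookup x∉xs (∈-lookup i) (sym eq))
unique⇒lookup-injective (_ ∷ unique) {fsuc i} {fsuc j} eq =
  cong fsuc (unique⇒lookup-injective unique eq)

isCard-injective⇒≤ : {A B : Set} {S : A → Set} {T : B → Set} {a b : ℕ} (f : A → B) →
  (∀ {x} → S x → T (f x)) → (∀ {x y} → S x → S y → f x ≡ f y → x ≡ y) →
  IsCard S a → IsCard T b → a ≤ b
isCard-injective⇒≤ {B = B} {S = S} f S⇒T f-injective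
  (xs , xs-unique , xs⇔S , refl) (ys , _ , ys⇔T , refl) = injective⇒≤ position-injective
  where
    inS : (i : Fin (length xs)) → S (lookup xs i)
    inS i = Equivalence.to (xs⇔S _) (∈-lookup i)
    image∈ys : (i : Fin (length xs)) → f (lookup xs i) ∈ ys
    image∈ys i = Equivalence.from (ys⇔T _) (S⇒T (inS i))
    position-injective : ∀ {i j} → index (image∈ys i) ≡ index (image∈ys j) → i ≡ j
    position-injective {i} {j} eq = unique⇒lookup-injective xs-unique
      (f-injective (inS i) (inS j) (index-injective (setoid B) (image∈ys i) (image∈ys j) eq))

module ShortestPaths {n : ℕ} (G : Digraph n) where

  -- A path of length L is a sequence read on the positions 0 … L only; its values beyond L are
  -- irrelevant. This avoids the index arithmetic of Fin when cutting and extending paths.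
  Seq : Set
  Seq = ℕ → V G

  record IsPathℕ (g : Seq) (L : ℕ) : Set where
    field
      injective : ∀ i j → i ≤ L → j ≤ L → g i ≡ g j → i ≡ j
      edge      : ∀ i → i < L → Edge G (g i) (g (suc i))

  PathOfLenℕ : V G → V G → ℕ → Set
  PathOfLenℕ u w L = Σ Seq λ g → IsPathℕ g L × g 0 ≡ u × g L ≡ w

  record IsShortest (g : Seq) (L : ℕ) : Set where
    field
      isPath  : IsPathℕ g L
      minimal : ∀ j → PathOfLenℕ (g 0) (g L) j → L ≤ j

  Chordless : Seq → ℕ → Set
  Chordless g L = ∀ i j → i ≤ L → j ≤ L → Edge G (g i) (g j) → j ≡ suc i

  NonAdjacent : V G → V G → Set
  NonAdjacent x y = ¬ Edge G x y × ¬ Edge G y x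

  Visits : Seq → ℕ → V G → Set
  Visits g ℓ w = ∃ λ i → i < suc ℓ × g i ≡ w

  snoc : Seq → ℕ → V G → Seq
  snoc g ℓ z t with t ≤? ℓ
  ... | yes _ = g t
  ... | no _  = z

  cons : V G → Seq → Seq
  cons x g zero    = x
  cons x g (suc t) = g t

  module _ (g : Seq) (ℓ : ℕ) (z : V G) where

    snoc-≤ : ∀ {t} → t ≤ ℓ → snoc g ℓ z t ≡ g t
    snoc-≤ {t} t≤ℓ with t ≤? ℓ
    ... | yes _   = refl
    ... | no t≰ℓ = ⊥-elim (t≰ℓ t≤ℓ)

    snoc-last : snoc g ℓ z (suc ℓ) ≡ z
    snoc-last with suc ℓ ≤? ℓ
    ... | yes ℓ<ℓ = ⊥-elim (<-irrefl refl ℓ<ℓ)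
    ... | no _    = refl

  isPathℕ-prefix : ∀ {g L j} → IsPathℕ g L → j ≤ L → IsPathℕ g j
  isPathℕ-prefix p j≤L = record
    { injective = λ a b a≤j b≤j → injective a b (≤-trans a≤j j≤L) (≤-trans b≤j j≤L)
    ; edge      = λ a a<j → edge a (<-≤-trans a<j j≤L)
    }
    where open IsPathℕ p

  isPathℕ-drop : ∀ {g L} i → IsPathℕ g L → i ≤ L → IsPathℕ (λ t → g (i + t)) (L ∸ i)
  isPathℕ-drop {g} {L} i p i≤L = record
    { injective = λ a b a≤ b≤ eq →
        +-cancelˡ-≡ i a b (injective (i + a) (i + b) (shift a≤) (shift b≤) eq)
    ; edge      = λ a a< → subst (λ t → Edge G (g (i + a)) (g t)) (sym (+-suc i a))
                    (edge (i + a) (subst (_≤ L) (+-suc i a) (shift a<)))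
    }
    where
      open IsPathℕ p
      shift : ∀ {a} → a ≤ L ∸ i → i + a ≤ L
      shift a≤ = subst (_ ≤_) (m+[n∸m]≡n i≤L) (+-monoʳ-≤ i a≤)

  isPathℕ-snoc : ∀ {g ℓ z} → IsPathℕ g ℓ → Edge G (g ℓ) z → ¬ Visits g ℓ z →
    IsPathℕ (snoc g ℓ z) (suc ℓ)
  isPathℕ-snoc {g} {ℓ} {z} p gℓ→z z∉g = record { injective = injective′ ; edge = edge′ }
    where
      open IsPathℕ p
      h : Seq
      h = snoc g ℓ z
      h-≤ : ∀ {t} → t ≤ ℓ → h t ≡ g t
      h-≤ = snoc-≤ g ℓ z
      h-last : h (suc ℓ) ≡ z
      h-last = snoc-last g ℓ z
      z-at : ∀ {i} → i < suc ℓ → h i ≡ z → Visits g ℓ z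
      z-at {i} i<1+ℓ hi≡z = i , i<1+ℓ , trans (sym (h-≤ (≤-pred i<1+ℓ))) hi≡z
      injective′ : ∀ i j → i ≤ suc ℓ → j ≤ suc ℓ → h i ≡ h j → i ≡ j
      injective′ i j i≤ j≤ hi≡hj with m≤n⇒m<n∨m≡n i≤ | m≤n⇒m<n∨m≡n j≤
      ... | inj₁ (s≤s i≤ℓ) | inj₁ (s≤s j≤ℓ) =
        injective i j i≤ℓ j≤ℓ (trans (sym (h-≤ i≤ℓ)) (trans hi≡hj (h-≤ j≤ℓ)))
      ... | inj₁ i<1+ℓ | inj₂ refl  = ⊥-elim (z∉g (z-at i<1+ℓ (trans hi≡hj h-last)))
      ... | inj₂ refl  | inj₁ j<1+ℓ = ⊥-elim (z∉g (z-at j<1+ℓ (trans (sym hi≡hj) h-last)))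
      ... | inj₂ refl  | inj₂ refl  = refl
      edge′ : ∀ i → i < suc ℓ → Edge G (h i) (h (suc i))
      edge′ i (s≤s i≤ℓ) with m≤n⇒m<n∨m≡n i≤ℓ
      ... | inj₁ i<ℓ  = subst₂ (Edge G) (sym (h-≤ (<⇒≤ i<ℓ))) (sym (h-≤ i<ℓ)) (edge i i<ℓ)
      ... | inj₂ refl = subst₂ (Edge G) (sym (h-≤ ≤-refl)) (sym h-last) gℓ→z

  isPathℕ-cons : ∀ {g ℓ x} → IsPathℕ g ℓ → Edge G x (g 0) → ¬ Visits g ℓ x →
    IsPathℕ (cons x g) (suc ℓ)
  isPathℕ-cons {g} {ℓ} {x} p x→g0 x∉g = record { injective = injective′ ; edge = edge′ }
    where
      open IsPathℕ p
      injective′ : ∀ i j → i ≤ suc ℓ → j ≤ suc ℓ → cons x g i ≡ cons x g j → i ≡ j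
      injective′ zero    zero    _         _         _  = refl
      injective′ zero    (suc j) _         j<1+ℓ     eq = ⊥-elim (x∉g (j , j<1+ℓ , sym eq))
      injective′ (suc i) zero    i<1+ℓ     _         eq = ⊥-elim (x∉g (i , i<1+ℓ , eq))
      injective′ (suc i) (suc j) (s≤s i≤ℓ) (s≤s j≤ℓ) eq =
        cong suc (injective i j i≤ℓ j≤ℓ eq)
      edge′ : ∀ i → i < suc ℓ → Edge G (cons x g i) (cons x g (suc i))
      edge′ zero    _         = x→g0
      edge′ (suc i) (s≤s i<ℓ) = edge i i<ℓ

  -- If the new end vertex already lies on the path, cut the path there instead.
  pathOfLenℕ-extendʳ : ∀ {u y z a} → PathOfLenℕ u y a → Edge G y z →
    ∃ λ j → j ≤ suc a × PathOfLenℕ u z j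
  pathOfLenℕ-extendʳ {z = z} {a} (g , p , g0≡u , ga≡y) y→z with anyUpTo? (λ i → g i ≟ z) (suc a)
  ... | yes (i , s≤s i≤a , gi≡z) =
    i , m≤n⇒m≤1+n i≤a , g , isPathℕ-prefix p i≤a , g0≡u , gi≡z
  ... | no z∉g = suc a , ≤-refl , snoc g a z
      , isPathℕ-snoc p (subst (λ w → Edge G w z) (sym ga≡y) y→z) z∉g
      , trans (snoc-≤ g a z z≤n) g0≡u , snoc-last g a z

  pathOfLenℕ-extendˡ : ∀ {x u w a} → Edge G x u → PathOfLenℕ u w a →
    ∃ λ j → j ≤ suc a × PathOfLenℕ x w j
  pathOfLenℕ-extendˡ {x} {a = a} x→u (g , p , g0≡u , ga≡w) with anyUpTo? (λ i → g i ≟ x) (suc a)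
  ... | yes (i , s≤s i≤a , gi≡x) = a ∸ i , ≤-trans (m∸n≤m a i) (n≤1+n a) , (λ t → g (i + t))
      , isPathℕ-drop i p i≤a , trans (cong g (+-identityʳ i)) gi≡x
      , trans (cong g (m+[n∸m]≡n i≤a)) ga≡w
  ... | no x∉g = suc a , ≤-refl , cons x g
      , isPathℕ-cons p (subst (Edge G x) (sym g0≡u) x→u) x∉g , refl , ga≡w

  -- Subpaths and extensions of shortest paths

  minimal-≤ : ∀ {g L j} → IsShortest g L →
    (∃ λ j′ → j′ ≤ j × PathOfLenℕ (g 0) (g L) j′) → L ≤ j
  minimal-≤ s (j′ , j′≤j , q) = ≤-trans (IsShortest.minimal s j′ q) j′≤j

  isShortest-init : ∀ {g ℓ} → IsShortest g (suc ℓ) → IsShortest g ℓ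
  isShortest-init {ℓ = ℓ} s = record
    { isPath  = isPathℕ-prefix isPath (n≤1+n ℓ)
    ; minimal = λ j q →
        ≤-pred (minimal-≤ s (pathOfLenℕ-extendʳ q (IsPathℕ.edge isPath ℓ ≤-refl)))
    }
    where open IsShortest s

  isShortest-tail : ∀ {g ℓ} → IsShortest g (suc ℓ) → IsShortest (λ t → g (suc t)) ℓ
  isShortest-tail s = record
    { isPath  = isPathℕ-drop 1 isPath (s≤s z≤n)
    ; minimal = λ j q →
        ≤-pred (minimal-≤ s (pathOfLenℕ-extendˡ (IsPathℕ.edge isPath 0 (s≤s z≤n)) q))
    }
    where open IsShortest s

  isShortest-prefix : ∀ d {g L} → IsShortest g (d + L) → IsShortest g L
  isShortest-prefix zero    s = s
  isShortest-prefix (suc d) s = isShortest-prefix d (isShortest-init s)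

  isShortest-drop : ∀ i {g L} → IsShortest g (i + L) → IsShortest (λ t → g (i + t)) L
  isShortest-drop zero    s = s
  isShortest-drop (suc i) s = isShortest-drop i (isShortest-tail s)

  isShortest-slice : ∀ {g L} i d → IsShortest g L → i + d ≤ L → IsShortest (λ t → g (i + t)) d
  isShortest-slice {g} {L} i d s i+d≤L = isShortest-drop i
    (isShortest-prefix (L ∸ (i + d)) (subst (IsShortest g) (sym (m∸n+n≡m i+d≤L)) s))

  isShortest-snoc : ∀ {g ℓ z} → IsShortest g ℓ → Edge G (g ℓ) z →
    (∀ j → PathOfLenℕ (g 0) z j → suc ℓ ≤ j) → IsShortest (snoc g ℓ z) (suc ℓ)
  isShortest-snoc {g} {ℓ} {z} s gℓ→z z-far = record
    { isPath  = isPathℕ-snoc isPath gℓ→z z∉g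
    ; minimal = λ j q → z-far j
        (subst₂ (λ a b → PathOfLenℕ a b j) (snoc-≤ g ℓ z z≤n) (snoc-last g ℓ z) q)
    }
    where
      open IsShortest s
      z∉g : ¬ Visits g ℓ z
      z∉g (i , s≤s i≤ℓ , gi≡z) =
        1+n≰n (≤-trans (z-far i (g , isPathℕ-prefix isPath i≤ℓ , refl , gi≡z)) i≤ℓ)

  isShortest-cons : ∀ {g ℓ x} → IsShortest g ℓ → Edge G x (g 0) →
    (∀ j → PathOfLenℕ x (g ℓ) j → suc ℓ ≤ j) → IsShortest (cons x g) (suc ℓ)
  isShortest-cons {g} {ℓ} {x} s x→g0 x-far = record
    { isPath  = isPathℕ-cons isPath x→g0 x∉g
    ; minimal = x-far
    }
    where
      open IsShortest s
      x∉g : ¬ Visits g ℓ x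
      x∉g (i , s≤s i≤ℓ , gi≡x) = 1+n≰n (≤-trans (x-far (ℓ ∸ i) suffix) (m∸n≤m ℓ i))
        where
          suffix : PathOfLenℕ x (g ℓ) (ℓ ∸ i)
          suffix = (λ t → g (i + t)) , isPathℕ-drop i isPath i≤ℓ
                 , trans (cong g (+-identityʳ i)) gi≡x , cong g (m+[n∸m]≡n i≤ℓ)

  record Agrees {r : ℕ} (p : Vector (V G) r) (g : Seq) : Set where
    constructor agrees
    field at : ∀ i → p i ≡ g (toℕ i)
  open Agrees

  -- Positions past the end read the first vertex.
  lookupℕ : ∀ {ℓ} → Vector (V G) (suc ℓ) → Seq
  lookupℕ {ℓ} p t with t <? suc ℓ
  ... | yes t<r = p (fromℕ< t<r)
  ... | no _    = p fzero

  agrees-lookupℕ : ∀ {ℓ} (p : Vector (V G) (suc ℓ)) → Agrees p (lookupℕ p)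
  agrees-lookupℕ {ℓ} p = agrees p≡
    where
      p≡ : ∀ i → p i ≡ lookupℕ p (toℕ i)
      p≡ i with toℕ i <? suc ℓ
      ... | yes i<r = cong p (sym (fromℕ<-toℕ i i<r))
      ... | no i≮r  = ⊥-elim (i≮r (toℕ<n i))

  agrees-∷ : ∀ {r x g} {p : Vector (V G) r} → g 0 ≡ x → Agrees p (λ t → g (suc t)) →
    Agrees (x ∷ᵥ p) g
  agrees-∷ g0≡x p≡ = agrees λ { fzero → sym g0≡x ; (fsuc i) → at p≡ i }

  agrees-∷⁻ : ∀ {r x g} {p : Vector (V G) r} → Agrees (x ∷ᵥ p) g → Agrees p (λ t → g (suc t))
  agrees-∷⁻ x∷p≡ = agrees λ i → at x∷p≡ (fsuc i)

  agrees-[] : ∀ {g} → Agrees []ᵥ g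
  agrees-[] = agrees λ ()

  agrees-++ : ∀ {r s g} {p : Vector (V G) r} {q : Vector (V G) s} →
    Agrees p g → Agrees q (λ t → g (r + t)) → Agrees (p ++ q) g
  agrees-++ {r} {s} {g} {p} {q} p≡ q≡ = agrees p++q≡
    where
      p++q≡ : ∀ i → (p ++ q) i ≡ g (toℕ i)
      p++q≡ i with splitAt r i in eq
      ... | inj₁ j =
        trans (at p≡ j) (cong g (trans (sym (toℕ-↑ˡ j s)) (cong toℕ (splitAt⁻¹-↑ˡ eq))))
      ... | inj₂ j =
        trans (at q≡ j) (cong g (trans (sym (toℕ-↑ʳ r j)) (cong toℕ (splitAt⁻¹-↑ʳ eq))))

  agrees-++ʳ : ∀ {r s g} {p : Vector (V G) r} {q : Vector (V G) s} →
    Agrees (p ++ q) g → Agrees q (λ t → g (r + t))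
  agrees-++ʳ {r} {g = g} {p} {q} p++q≡ = agrees λ j →
    trans (sym (lookup-++ʳ p q j)) (trans (at p++q≡ (r ↑ʳ j)) (cong g (toℕ-↑ʳ r j)))

  module _ {ℓ : ℕ} {p : Vector (V G) (suc ℓ)} {g : Seq} (agree : Agrees p g) where

    agrees-fromℕ< : ∀ {i} (i<r : i < suc ℓ) → p (fromℕ< i<r) ≡ g i
    agrees-fromℕ< i<r = trans (at agree _) (cong g (toℕ-fromℕ< i<r))

    agrees-last : p (fromℕ ℓ) ≡ g ℓ
    agrees-last = trans (at agree _) (cong g (toℕ-fromℕ ℓ))

    isPath⇒isPathℕ : IsPath G p → IsPathℕ g ℓ
    isPath⇒isPathℕ (p-injective , p-edge) = record
      { injective = λ i j i≤ℓ j≤ℓ gi≡gj → fromℕ<-injective i j (s≤s i≤ℓ) (s≤s j≤ℓ)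
          (p-injective (trans (agrees-fromℕ< (s≤s i≤ℓ))
                              (trans gi≡gj (sym (agrees-fromℕ< (s≤s j≤ℓ))))))
      ; edge      = λ i i<ℓ →
          subst₂ (Edge G) (agrees-fromℕ< (s≤s (<⇒≤ i<ℓ))) (agrees-fromℕ< (s≤s i<ℓ)) (p-edge _ _
            (trans (toℕ-fromℕ< (s≤s i<ℓ)) (cong suc (sym (toℕ-fromℕ< (s≤s (<⇒≤ i<ℓ)))))))
      }

    isPathℕ⇒isPath : IsPathℕ g ℓ → IsPath G p
    isPathℕ⇒isPath path =
      (λ {a} {b} pa≡pb → toℕ-injective
        (injective (toℕ a) (toℕ b) (toℕ≤pred[n] a) (toℕ≤pred[n] b)
          (trans (sym (at agree a)) (trans pa≡pb (at agree b)))))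
      , λ a b b≡1+a →
          subst₂ (Edge G) (sym (at agree a)) (trans (cong g (sym b≡1+a)) (sym (at agree b)))
            (edge (toℕ a) (subst (_≤ ℓ) b≡1+a (toℕ≤pred[n] b)))
      where open IsPathℕ path

    induced⇒chordless : (∀ i j → Edge G (p i) (p j) → toℕ j ≡ suc (toℕ i)) → Chordless g ℓ
    induced⇒chordless induced i j i≤ℓ j≤ℓ gi→gj = trans (sym (toℕ-fromℕ< (s≤s j≤ℓ)))
      (trans (induced _ _ pi→pj) (cong suc (toℕ-fromℕ< (s≤s i≤ℓ))))
      where
        pi→pj : Edge G (p (fromℕ< (s≤s i≤ℓ))) (p (fromℕ< (s≤s j≤ℓ)))
        pi→pj = subst₂ (Edge G) (sym (agrees-fromℕ< (s≤s i≤ℓ))) (sym (agrees-fromℕ< (s≤s j≤ℓ)))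
                  gi→gj

    chordless⇒induced : Chordless g ℓ → ∀ i j → Edge G (p i) (p j) → toℕ j ≡ suc (toℕ i)
    chordless⇒induced chordless i j pi→pj = chordless _ _ (toℕ≤pred[n] i) (toℕ≤pred[n] j)
      (subst₂ (Edge G) (at agree i) (at agree j) pi→pj)

  pathOfLen⇒ℕ : ∀ {u w ℓ} → PathOfLen G u w ℓ → PathOfLenℕ u w ℓ
  pathOfLen⇒ℕ (p , path , p0≡u , pℓ≡w) = lookupℕ p , isPath⇒isPathℕ agree path
    , trans (sym (at agree fzero)) p0≡u , trans (sym (agrees-last agree)) pℓ≡w
    where
      agree : Agrees p (lookupℕ p)
      agree = agrees-lookupℕ p

  pathOfLenℕ⇒ : ∀ {u w ℓ} → PathOfLenℕ u w ℓ → PathOfLen G u w ℓ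
  pathOfLenℕ⇒ {ℓ = ℓ} (g , path , g0≡u , gℓ≡w) = (λ i → g (toℕ i))
    , isPathℕ⇒isPath (agrees λ _ → refl) path , g0≡u , trans (cong g (toℕ-fromℕ ℓ)) gℓ≡w

  dist-minimal : ∀ {u w L} → Dist G u w L → ∀ j → PathOfLenℕ u w j → L ≤ j
  dist-minimal (_ , minimal) j q = minimal j (pathOfLenℕ⇒ q)

  dist⇒shortest : ∀ {u w L} → Dist G u w L → Σ Seq λ g → IsShortest g L × g 0 ≡ u × g L ≡ w
  dist⇒shortest d@(q , _) with pathOfLen⇒ℕ q
  ... | g , path , refl , refl = g , record { isPath = path ; minimal = dist-minimal d } , refl , refl

  shortest⇒dist : ∀ {g L} → IsShortest g L → Dist G (g 0) (g L) L
  shortest⇒dist {g} s =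
    pathOfLenℕ⇒ (g , isPath , refl , refl) , λ j q → minimal j (pathOfLen⇒ℕ q)
    where open IsShortest s

  module _ {ℓ : ℕ} {p : Vector (V G) (suc ℓ)} {g : Seq} (agree : Agrees p g) where

    shortestInduced⇒isShortest : ∀ {L} → ℓ ≡ L → ShortestInduced G p → IsShortest g L
    shortestInduced⇒isShortest refl ((path , _) , (_ , minimal)) = record
      { isPath  = isPath⇒isPathℕ agree path
      ; minimal = λ j q → minimal j (pathOfLenℕ⇒
          (subst₂ (λ a b → PathOfLenℕ a b j) (sym (at agree fzero)) (sym (agrees-last agree)) q))
      }

    shortestInduced⇒chordless : ∀ {L} → ℓ ≡ L → ShortestInduced G p → Chordless g L
    shortestInduced⇒chordless refl ((_ , induced) , _) = induced⇒chordless agree induced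

    isShortest⇒shortestInduced : ∀ {L} → ℓ ≡ L → IsShortest g L → Chordless g L →
      ShortestInduced G p
    isShortest⇒shortestInduced refl s chordless =
      (isPathℕ⇒isPath agree (IsShortest.isPath s) , chordless⇒induced agree chordless)
      , subst₂ (λ a b → Dist G a b ℓ) (sym (at agree fzero)) (sym (agrees-last agree))
          (shortest⇒dist s)

  dist-between : ∀ {g L} i d {j} → IsShortest g L → i + d ≡ j → j ≤ L → Dist G (g i) (g j) d
  dist-between {g} i d s refl i+d≤L = subst (λ u → Dist G u (g (i + d)) d) (cong g (+-identityʳ i))
    (shortest⇒dist (isShortest-slice i d s i+d≤L))

  -- Shortest paths are induced

  -- A backward chord g a → g b (b ≤ a) closes a cycle of length a - b + 1 ≤ L + 1; a forward chord
  -- skipping a vertex would shortcut the shortest path g 0 … g b.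
  isShortest⇒chordless : ∀ {m g L} → MFree G m → suc L ≤ m → IsShortest g L → Chordless g L
  isShortest⇒chordless {m} {g} {L} mfree 1+L≤m s a b a≤L b≤L ga→gb with b ≤? a
  ... | yes b≤a =
    ⊥-elim (mfree (a ∸ b) (≤-trans (s≤s (≤-trans (m∸n≤m a b) a≤L)) 1+L≤m) cycle)
    where
      open IsShortest s
      last≡a : b + toℕ (fromℕ (a ∸ b)) ≡ a
      last≡a = trans (cong (b +_) (toℕ-fromℕ (a ∸ b))) (m+[n∸m]≡n b≤a)
      cycle : HasCycleOfLen G (a ∸ b)
      cycle = (λ t → g (b + toℕ t))
            , isPathℕ⇒isPath (agrees λ _ → refl) (isPathℕ-drop b (isPathℕ-prefix isPath a≤L) b≤a)
            , subst₂ (Edge G) (cong g (sym last≡a)) (cong g (sym (+-identityʳ b))) ga→gb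
  ... | no b≰a = ≤-antisym b≤1+a (≰⇒> b≰a)
    where
      open IsShortest s
      b≤1+a : b ≤ suc a
      b≤1+a = minimal-≤ (isShortest-slice 0 b s b≤L)
                (pathOfLenℕ-extendʳ (g , isPathℕ-prefix isPath a≤L , refl , refl) ga→gb)

  chordless-slice : ∀ {g L} i d → Chordless g L → i + d ≤ L → Chordless (λ t → g (i + t)) d
  chordless-slice i d chordless i+d≤L a b a≤d b≤d e =
    +-cancelˡ-≡ i _ _ (trans (chordless (i + a) (i + b) (within a≤d) (within b≤d) e) (sym (+-suc i a)))
    where
      within : ∀ {t} → t ≤ d → i + t ≤ _
      within t≤d = ≤-trans (+-monoʳ-≤ i t≤d) i+d≤L

  chordless⇒nonAdjacent : ∀ {g L} i j → Chordless g L → i ≤ L → j ≤ L → suc i < j →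
    NonAdjacent (g i) (g j)
  chordless⇒nonAdjacent i j chordless i≤L j≤L 1+i<j =
    (λ gi→gj → <⇒≢ 1+i<j (sym (chordless i j i≤L j≤L gi→gj)))
    , λ gj→gi →
        <-asym (subst (_< j) (chordless j i j≤L i≤L gj→gi) (<-trans (n<1+n i) 1+i<j)) (n<1+n j)

  slice∈𝒫 : ∀ {g L} i k → IsShortest g L → Chordless g L → i + k < L →
    InP G (suc k) (λ t → g (i + toℕ t))
  slice∈𝒫 i k s chordless i+k<L = isShortest⇒shortestInduced (agrees λ _ → refl) refl
    (isShortest-slice i k s (<⇒≤ i+k<L)) (chordless-slice i k chordless (<⇒≤ i+k<L))

  xpyz⇒ℕ : ∀ {k x y z} → XPYZ G k (x , y , z) → Σ Seq λ g →
    IsShortest g (2 + k) × Chordless g (2 + k) × (g 0 , g (1 + k) , g (2 + k)) ≡ (x , y , z)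
  xpyz⇒ℕ {k} {x} {y} {z} (P , _ , si) =
    g , shortestInduced⇒isShortest agree (+-comm k 2) si
      , shortestInduced⇒chordless agree (+-comm k 2) si
      , cong₂ _,_ (sym (at agree fzero)) (cong₂ _,_ g[1+k]≡y g[2+k]≡z)
    where
      W : Vector (V G) (suc (k + 2))
      W = x ∷ᵥ (P ++ (y ∷ᵥ (z ∷ᵥ []ᵥ)))
      g : Seq
      g = lookupℕ W
      agree : Agrees W g
      agree = agrees-lookupℕ W
      yz : Agrees (y ∷ᵥ (z ∷ᵥ []ᵥ)) (λ t → g (suc (k + t)))
      yz = agrees-++ʳ (agrees-∷⁻ agree)
      g[1+k]≡y : g (1 + k) ≡ y
      g[1+k]≡y = trans (cong (λ t → g (suc t)) (sym (+-identityʳ k))) (sym (at yz fzero))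
      g[2+k]≡z : g (2 + k) ≡ z
      g[2+k]≡z = trans (cong (λ t → g (suc t)) (+-comm 1 k)) (sym (at yz (fsuc fzero)))

  xypz⇒ℕ : ∀ {k x y z} → XYPZ G k (x , y , z) → Σ Seq λ g →
    IsShortest g (2 + k) × Chordless g (2 + k) × (g 0 , g 1 , g (2 + k)) ≡ (x , y , z)
  xypz⇒ℕ {k} {x} {y} {z} (P , _ , si) =
    g , shortestInduced⇒isShortest agree ℓ≡2+k si , shortestInduced⇒chordless agree ℓ≡2+k si
      , cong₂ _,_ (sym (at agree fzero)) (cong₂ _,_ (sym (at agree (fsuc fzero))) g[2+k]≡z)
    where
      ℓ≡2+k : suc (k + 1) ≡ 2 + k
      ℓ≡2+k = cong suc (+-comm k 1)
      W : Vector (V G) (suc (suc (k + 1)))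
      W = x ∷ᵥ (y ∷ᵥ (P ++ (z ∷ᵥ []ᵥ)))
      g : Seq
      g = lookupℕ W
      agree : Agrees W g
      agree = agrees-lookupℕ W
      z′ : Agrees (z ∷ᵥ []ᵥ) (λ t → g (suc (suc (k + t))))
      z′ = agrees-++ʳ (agrees-∷⁻ (agrees-∷⁻ agree))
      g[2+k]≡z : g (2 + k) ≡ z
      g[2+k]≡z = trans (cong (λ t → g (suc (suc t))) (sym (+-identityʳ k))) (sym (at z′ fzero))

  ℕ⇒xpyz : ∀ {k g} → IsShortest g (3 + k) → Chordless g (3 + k) →
    XPYZ G (suc k) (g 0 , g (2 + k) , g (3 + k))
  ℕ⇒xpyz {k} {g} s chordless = P , slice∈𝒫 1 k s chordless (s≤s (s≤s (n≤1+n k)))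
    , isShortest⇒shortestInduced agree (cong suc (+-comm k 2)) s chordless
    where
      P : Vector (V G) (suc k)
      P t = g (1 + toℕ t)
      agree : Agrees (g 0 ∷ᵥ (P ++ (g (2 + k) ∷ᵥ (g (3 + k) ∷ᵥ []ᵥ)))) g
      agree = agrees-∷ refl (agrees-++ (agrees λ _ → refl)
                (agrees-∷ (cong (λ t → g (2 + t)) (+-identityʳ k))
                  (agrees-∷ (cong (λ t → g (2 + t)) (+-comm k 1)) agrees-[])))

  ℕ⇒xypz : ∀ {k g} → IsShortest g (3 + k) → Chordless g (3 + k) →
    XYPZ G (suc k) (g 0 , g 1 , g (3 + k))
  ℕ⇒xypz {k} {g} s chordless = P , slice∈𝒫 2 k s chordless ≤-refl
    , isShortest⇒shortestInduced agree (cong (2 +_) (+-comm k 1)) s chordless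
    where
      P : Vector (V G) (suc k)
      P t = g (2 + toℕ t)
      agree : Agrees (g 0 ∷ᵥ (g 1 ∷ᵥ (P ++ (g (3 + k) ∷ᵥ []ᵥ)))) g
      agree = agrees-∷ refl (agrees-∷ refl (agrees-++ (agrees λ _ → refl)
                (agrees-∷ (cong (λ t → g (3 + t)) (+-identityʳ k)) agrees-[])))

  record XPYZ-Facts (k : ℕ) (x y z : V G) : Set where
    field
      x⇝y : Dist G x y (suc k)
      y⇝z : Dist G y z 1
      x⇝z : Dist G x z (2 + k)
      y→z : Edge G y z
      x≁y : NonAdjacent x y
      x≁z : NonAdjacent x z

  xpyz-facts : ∀ {k x y z} → XPYZ G k (x , y , z) → XPYZ-Facts k x y z
  xpyz-facts {zero} (_ , () , _)
  xpyz-facts {suc k} xpyz with xpyz⇒ℕ xpyz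
  ... | g , s , chordless , refl = record
    { x⇝y = dist-between 0 (2 + k) s refl (n≤1+n _)
    ; y⇝z = dist-between (2 + k) 1 s (+-comm (2 + k) 1) ≤-refl
    ; x⇝z = dist-between 0 (3 + k) s refl ≤-refl
    ; y→z = IsPathℕ.edge (IsShortest.isPath s) (2 + k) ≤-refl
    ; x≁y = chordless⇒nonAdjacent 0 (2 + k) chordless z≤n (n≤1+n _) (s≤s (s≤s z≤n))
    ; x≁z = chordless⇒nonAdjacent 0 (3 + k) chordless z≤n ≤-refl (s≤s (s≤s z≤n))
    }

  record XYPZ-Facts (k : ℕ) (x y z : V G) : Set where
    field
      x⇝y : Dist G x y 1
      y⇝z : Dist G y z (suc k)
      x⇝z : Dist G x z (2 + k)
      x→y : Edge G x y
      x≁z : NonAdjacent x z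
      y≁z : NonAdjacent y z

  xypz-facts : ∀ {k x y z} → XYPZ G k (x , y , z) → XYPZ-Facts k x y z
  xypz-facts {zero} (_ , () , _)
  xypz-facts {suc k} xypz with xypz⇒ℕ xypz
  ... | g , s , chordless , refl = record
    { x⇝y = dist-between 0 1 s refl (s≤s z≤n)
    ; y⇝z = dist-between 1 (2 + k) s refl ≤-refl
    ; x⇝z = dist-between 0 (3 + k) s refl ≤-refl
    ; x→y = IsPathℕ.edge (IsShortest.isPath s) 0 (s≤s z≤n)
    ; x≁z = chordless⇒nonAdjacent 0 (3 + k) chordless z≤n ≤-refl (s≤s (s≤s z≤n))
    ; y≁z = chordless⇒nonAdjacent 1 (3 + k) chordless (s≤s z≤n) ≤-refl (s≤s (s≤s (s≤s z≤n)))
    }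

  xpyz-of-edge : ∀ {m k x y z} → MFree G m → 4 + k ≤ m →
    Dist G x y (2 + k) → Dist G x z (3 + k) → Edge G y z → XPYZ G (suc k) (x , y , z)
  xpyz-of-edge {k = k} {z = z} mfree bound x⇝y x⇝z y→z with dist⇒shortest x⇝y
  ... | g , s , refl , refl =
    subst (XPYZ G (suc k)) ends (ℕ⇒xpyz s′ (isShortest⇒chordless mfree bound s′))
    where
      s′ : IsShortest (snoc g (2 + k) z) (3 + k)
      s′ = isShortest-snoc s y→z (dist-minimal x⇝z)
      h : Seq
      h = snoc g (2 + k) z
      ends : (h 0 , h (2 + k) , h (3 + k)) ≡ (g 0 , g (2 + k) , z)
      ends = cong₂ _,_ (snoc-≤ g (2 + k) z z≤n)
               (cong₂ _,_ (snoc-≤ g (2 + k) z ≤-refl) (snoc-last g (2 + k) z))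

  xypz-of-edge : ∀ {m k x y z} → MFree G m → 4 + k ≤ m →
    Dist G x z (3 + k) → Dist G y z (2 + k) → Edge G x y → XYPZ G (suc k) (x , y , z)
  xypz-of-edge {x = x} mfree bound x⇝z y⇝z x→y with dist⇒shortest y⇝z
  ... | g , s , refl , refl = ℕ⇒xypz s′ (isShortest⇒chordless mfree bound s′)
    where
      s′ : IsShortest (cons x g) _
      s′ = isShortest-cons s x→y (dist-minimal x⇝z)

  Pk-card : ∀ {m} k v → 1 ≤ k → 3 + k ≤ m → MFree G m →
    ∀ a b → IsCard (Pk G k v) a →
    IsCard (EdgesBetween G (Nout G (suc k) v) (Nout G (suc (suc k)) v)) b → a ≡ b
  Pk-card (suc k) v _ bound mfree _ _ |Pk| |E| =
    ≤-antisym (isCard-injective⇒≤ proj₂ into injective |Pk| |E|)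
              (isCard-injective⇒≤ (v ,_) from (λ _ _ → cong proj₂) |E| |Pk|)
    where
      E : V G × V G → Set
      E = EdgesBetween G (Nout G (2 + k) v) (Nout G (3 + k) v)
      into : ∀ {t} → Pk G (suc k) v t → E (proj₂ t)
      into {_ , _ , _} (refl , xpyz) = (s≤s z≤n , x⇝y) , (s≤s z≤n , x⇝z) , y→z
        where open XPYZ-Facts (xpyz-facts xpyz)
      injective : ∀ {t t′} → Pk G (suc k) v t → Pk G (suc k) v t′ →
        proj₂ t ≡ proj₂ t′ → t ≡ t′
      injective {_ , _ , _} {_ , _ , _} (refl , _) (refl , _) refl = refl
      from : ∀ {e} → E e → Pk G (suc k) v (v , e)
      from {_ , _} ((_ , v⇝y) , (_ , v⇝z) , y→z) =
        refl , xpyz-of-edge mfree bound v⇝y v⇝z y→z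

  Qk-card-≤ : ∀ k v a b → IsCard (Qk G k v) a →
    IsCard (NonEdgesBetween G (Nin G (suc k) v) (Nout G 1 v)) b → a ≤ b
  Qk-card-≤ k v _ _ = isCard-injective⇒≤ drop-y into injective
    where
      drop-y : Triple G → V G × V G
      drop-y (x , _ , z) = x , z
      into : ∀ {t} → Qk G k v t → NonEdgesBetween G (Nin G (suc k) v) (Nout G 1 v) (drop-y t)
      into {_ , _ , _} (refl , xpyz) = (s≤s z≤n , x⇝y) , (s≤s z≤n , y⇝z) , x≁z
        where open XPYZ-Facts (xpyz-facts xpyz)
      injective : ∀ {t t′} → Qk G k v t → Qk G k v t′ →
        drop-y t ≡ drop-y t′ → t ≡ t′
      injective {_ , _ , _} {_ , _ , _} (refl , _) (refl , _) refl = refl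

  Rk-card-≤ : ∀ k v a b → IsCard (Rk G k v) a →
    IsCard (NonEdgesBetween G (Nin G 1 v) (Nin G (suc (suc k)) v)) b → a ≤ b
  Rk-card-≤ k v _ _ = isCard-injective⇒≤ yx into injective
    where
      yx : Triple G → V G × V G
      yx (x , y , _) = y , x
      into : ∀ {t} → Rk G k v t → NonEdgesBetween G (Nin G 1 v) (Nin G (suc (suc k)) v) (yx t)
      into {_ , _ , _} (refl , xpyz) = (s≤s z≤n , y⇝z) , (s≤s z≤n , x⇝z) , swap x≁y
        where open XPYZ-Facts (xpyz-facts xpyz)
      injective : ∀ {t t′} → Rk G k v t → Rk G k v t′ → yx t ≡ yx t′ → t ≡ t′
      injective {_ , _ , _} {_ , _ , _} (refl , _) (refl , _) refl = refl

  Pk′-card-≤ : ∀ k v a b → IsCard (Pk' G k v) a →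
    IsCard (NonEdgesBetween G (Nout G 1 v) (Nout G (suc (suc k)) v)) b → a ≤ b
  Pk′-card-≤ k v _ _ = isCard-injective⇒≤ proj₂ into injective
    where
      into : ∀ {t} → Pk' G k v t →
        NonEdgesBetween G (Nout G 1 v) (Nout G (suc (suc k)) v) (proj₂ t)
      into {_ , _ , _} (refl , xypz) = (s≤s z≤n , x⇝y) , (s≤s z≤n , x⇝z) , y≁z
        where open XYPZ-Facts (xypz-facts xypz)
      injective : ∀ {t t′} → Pk' G k v t → Pk' G k v t′ →
        proj₂ t ≡ proj₂ t′ → t ≡ t′
      injective {_ , _ , _} {_ , _ , _} (refl , _) (refl , _) refl = refl

  Qk′-card-≤ : ∀ k v a b → IsCard (Qk' G k v) a →
    IsCard (NonEdgesBetween G (Nout G (suc k) v) (Nin G 1 v)) b → a ≤ b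
  Qk′-card-≤ k v _ _ = isCard-injective⇒≤ zx into injective
    where
      zx : Triple G → V G × V G
      zx (x , _ , z) = z , x
      into : ∀ {t} → Qk' G k v t → NonEdgesBetween G (Nout G (suc k) v) (Nin G 1 v) (zx t)
      into {_ , _ , _} (refl , xypz) = (s≤s z≤n , y⇝z) , (s≤s z≤n , x⇝y) , swap x≁z
        where open XYPZ-Facts (xypz-facts xypz)
      injective : ∀ {t t′} → Qk' G k v t → Qk' G k v t′ →
        zx t ≡ zx t′ → t ≡ t′
      injective {_ , _ , _} {_ , _ , _} (refl , _) (refl , _) refl = refl

  Rk′-card : ∀ {m} k v → 1 ≤ k → 3 + k ≤ m → MFree G m →
    ∀ a b → IsCard (Rk' G k v) a →
    IsCard (EdgesBetween G (Nin G (suc (suc k)) v) (Nin G (suc k) v)) b → a ≡ b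
  Rk′-card (suc k) v _ bound mfree _ _ |Rk′| |E| =
    ≤-antisym (isCard-injective⇒≤ drop-z into injective |Rk′| |E|)
              (isCard-injective⇒≤ (λ (x , y) → x , y , v) from (λ _ _ → cong drop-z) |E| |Rk′|)
    where
      drop-z : Triple G → V G × V G
      drop-z (x , y , _) = x , y
      E : V G × V G → Set
      E = EdgesBetween G (Nin G (3 + k) v) (Nin G (2 + k) v)
      into : ∀ {t} → Rk' G (suc k) v t → E (drop-z t)
      into {_ , _ , _} (refl , xypz) = (s≤s z≤n , x⇝z) , (s≤s z≤n , y⇝z) , x→y
        where open XYPZ-Facts (xypz-facts xypz)
      injective : ∀ {t t′} → Rk' G (suc k) v t → Rk' G (suc k) v t′ →
        drop-z t ≡ drop-z t′ → t ≡ t′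
      injective {_ , _ , _} {_ , _ , _} (refl , _) (refl , _) refl = refl
      from : ∀ {e} → E e → Rk' G (suc k) v (proj₁ e , proj₂ e , v)
      from {_ , _} ((_ , x⇝v) , (_ , y⇝v) , x→y) =
        refl , xypz-of-edge mfree bound x⇝v y⇝v x→y

lemma2p3 : (m : ℕ) → 4 ≤ m → (n : ℕ) → (G : Digraph n) → MFree G m →
    (v : V G) → (k : ℕ) → 1 ≤ k → k ≤ m ∸ 3 →
    (∀ a b → IsCard (Pk G k v) a →
       IsCard (EdgesBetween G (Nout G (suc k) v) (Nout G (suc (suc k)) v)) b → a ≡ b)
    × (∀ a b → IsCard (Qk G k v) a →
       IsCard (NonEdgesBetween G (Nin G (suc k) v) (Nout G 1 v)) b → a ≤ b)
    × (∀ a b → IsCard (Rk G k v) a →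
       IsCard (NonEdgesBetween G (Nin G 1 v) (Nin G (suc (suc k)) v)) b → a ≤ b)
    × (∀ a b → IsCard (Pk' G k v) a →
       IsCard (NonEdgesBetween G (Nout G 1 v) (Nout G (suc (suc k)) v)) b → a ≤ b)
    × (∀ a b → IsCard (Qk' G k v) a →
       IsCard (NonEdgesBetween G (Nout G (suc k) v) (Nin G 1 v)) b → a ≤ b)
    × (∀ a b → IsCard (Rk' G k v) a →
       IsCard (EdgesBetween G (Nin G (suc (suc k)) v) (Nin G (suc k) v)) b → a ≡ b)
lemma2p3 m 4≤m n G mfree v k 1≤k k≤m∸3 =
  Pk-card k v 1≤k 3+k≤m mfree , Qk-card-≤ k v , Rk-card-≤ k v ,
  Pk′-card-≤ k v , Qk′-card-≤ k v , Rk′-card k v 1≤k 3+k≤m mfree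
  where
    open ShortestPaths G
    3+k≤m : 3 + k ≤ m
    3+k≤m = subst (_≤ m) (+-comm k 3)
      (m≤o∸n⇒m+n≤o k (≤-trans (n≤1+n 3) 4≤m) k≤m∸3)
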